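{- Let $M_0, M_1, M_2, \ldots$ be linear orders each equal to $\omega$ or $\omega^*$ which alternate (i.e. $M_{i+1} \neq M_i$), and let $m_i, n_i$ ($i < \omega$) be non-zero natural numbers. Let $A = M_0^{m_0} \cdot M_1^{m_1} \cdots$ and $B = M_0^{n_0} \cdot M_1^{n_1} \cdots$ be the corresponding $\omega$-monomial products. Then $A \equiv B$ if and only if $m_i = n_i$ for all $i$.
   Context: $\omega^*$ is the reverse of $\omega$. An infinite product $\prod_{i \in I} X_i$ of linear orders indexed by a well-ordered set $I$, each $X_i$ having a designated element $0$, is the restricted anti-lexicographic product: the set of functions $f$ with $f(i) \in X_i$ and $f(i) = 0$ for all but finitely many $i$, ordered by $f < g$ iff there is $i$ with $f(i) < g(i)$ and $f(j) = g(j)$ for all $j > i$. In the product $M_0^{m_0}\cdot M_1^{m_1}\cdots$ the factors are listed in increasing order of index (so $X \cdot Y$ is "$Y$ copies of $X$"), and $M^n$ stands for $n$ consecutive factors equal to $M$. $\equiv$ denotes elementary equivalence (equivalently, player II wins the $n$-move Ehrenfeucht–Fraïssé game for every $n$). -}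

module Defs where

open import Data.Nat using (ℕ; zero; suc; _<_; _≤_; _<ᵇ_)
open import Data.Bool using (Bool; true; false; if_then_else_)
open import Data.Fin using (Fin)
open import Data.Product using (Σ; _×_; _,_; proj₁; ∃)
open import Data.Sum using (_⊎_)
open import Data.Empty using (⊥)
open import Data.Unit using (⊤)
open import Relation.Binary.PropositionalEquality using (_≡_)

record Str : Set₁ where
  field
    Carrier : Set
    _≈_     : Carrier → Carrier → Set
    _≺_     : Carrier → Carrier → Set

-- First-order formulas with n free variables (de Bruijn, Fin n)

data Formula : ℕ → Set where
  eq   : ∀ {n} → Fin n → Fin n → Formula n
  lt   : ∀ {n} → Fin n → Fin n → Formula n
  ⊥f   : ∀ {n} → Formula n
  ⊤f   : ∀ {n} → Formula n
  _∧f_ : ∀ {n} → Formula n → Formula n → Formula n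
  _∨f_ : ∀ {n} → Formula n → Formula n → Formula n
  _⇒f_ : ∀ {n} → Formula n → Formula n → Formula n
  ∀f   : ∀ {n} → Formula (suc n) → Formula n
  ∃f   : ∀ {n} → Formula (suc n) → Formula n

Sentence : Set
Sentence = Formula 0

extend : {A : Set} {n : ℕ} → A → (Fin n → A) → Fin (suc n) → A
extend a ρ Fin.zero    = a
extend a ρ (Fin.suc i) = ρ i

Sat : (S : Str) {n : ℕ} → (Fin n → Str.Carrier S) → Formula n → Set
Sat S ρ (eq i j)  = Str._≈_ S (ρ i) (ρ j)
Sat S ρ (lt i j)  = Str._≺_ S (ρ i) (ρ j)
Sat S ρ ⊥f        = ⊥
Sat S ρ ⊤f        = ⊤
Sat S ρ (φ ∧f ψ)  = Sat S ρ φ × Sat S ρ ψ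
Sat S ρ (φ ∨f ψ)  = Sat S ρ φ ⊎ Sat S ρ ψ
Sat S ρ (φ ⇒f ψ)  = Sat S ρ φ → Sat S ρ ψ
Sat S ρ (∀f φ)    = (a : Str.Carrier S) → Sat S (extend a ρ) φ
Sat S ρ (∃f φ)    = Σ (Str.Carrier S) λ a → Sat S (extend a ρ) φ

noVars : {A : Set} → Fin 0 → A
noVars ()

_⊨_ : Str → Sentence → Set
S ⊨ φ = Sat S noVars φ

_≡ₑ_ : Str → Str → Set
A ≡ₑ B = (φ : Sentence) → (A ⊨ φ → B ⊨ φ) × (B ⊨ φ → A ⊨ φ)

-- Base orders ω (true) and ω* (false), both on ℕ, designated element 0.
-- In ω* the order on ℕ is reversed.

OrdType : Set
OrdType = Bool

ltBase : OrdType → ℕ → ℕ → Set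
ltBase true  a b = a < b
ltBase false a b = b < a

-- Factor k of M_0^{m_0}·M_1^{m_1}··· lies in block proj₁ (block m k),
-- at position proj₂ (block m k) within that block (assuming all m i ≥ 1).

block : (ℕ → ℕ) → ℕ → ℕ × ℕ
block m zero = (0 , 0)
block m (suc k) with block m k
... | (i , u) = if suc u <ᵇ m i then (i , suc u) else (suc i , 0)

factor : (ℕ → OrdType) → (ℕ → ℕ) → ℕ → OrdType
factor M m k = M (proj₁ (block m k))

-- Restricted anti-lexicographic product of a sequence of orders on ℕ
-- (each with designated element 0), indexed by ω.

record FinSupp : Set where
  constructor fs
  field
    fun     : ℕ → ℕ
    bound   : ℕ
    vanish  : ∀ j → bound ≤ j → fun j ≡ 0

open FinSupp public

Product : (ℕ → OrdType) → Str
Product X = record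
  { Carrier = FinSupp
  ; _≈_ = λ f g → ∀ i → fun f i ≡ fun g i
  ; _≺_ = λ f g → ∃ λ i → ltBase (X i) (fun f i) (fun g i)
                         × (∀ j → i < j → fun f j ≡ fun g j)
  }

Monomial : (ℕ → OrdType) → (ℕ → ℕ) → Str
Monomial M m = Product (factor M m)

module Submission where

-- In a restricted anti-lexicographic product P = ∏ₖ Xₖ, let Zₖ be the set of
-- elements vanishing at every coordinate below k.  Inside Zₖ, x has an immediate
-- predecessor and an immediate successor exactly when its k-th coordinate is nonzero,
-- so by induction each Zₖ is first-order definable.  Consequently the sentence
-- "every element of Zₖ has an immediate successor in Zₖ" holds in P iff Xₖ = ω, hence
-- the factor sequence (Xₖ)ₖ is an invariant of the elementary theory of P.

open import Defs
open import Data.Nat using (ℕ; suc; _≤_)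
open import Data.Bool using (Bool)
open import Data.Product using (_×_)
open import Relation.Binary.PropositionalEquality using (_≡_; _≢_)

open import Data.Nat using (zero; _<_; _<ᵇ_; _⊔_; s≤s⁻¹; _≟_)
open import Data.Nat.Properties
  using (<-irrefl; <-trans; <-≤-trans; <-cmp; ≮⇒≥; ≤-antisym; <⇒≢; >⇒≢; n≮0; n<1+n;
         m<n⇒m<1+n; m<1+n⇒m<n∨m≡n; m≤n⇒m<n∨m≡n; <⇒<ᵇ; <ᵇ⇒<;
         m⊔n≤o⇒m≤o; m⊔n≤o⇒n≤o)
open import Data.Bool using (true; false; if_then_else_)
open import Data.Fin using (Fin) renaming (zero to fzero; suc to fsuc)
open import Data.Product using (Σ; ∃; ∃₂; _,_; proj₁; proj₂)
open import Data.Sum using (_⊎_; inj₁; inj₂)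
open import Data.Empty using (⊥; ⊥-elim)
open import Data.Unit using (tt)
open import Function using (_∘_)
open import Function.Bundles using (_⇔_; mk⇔; Equivalence)
open import Relation.Nullary using (¬_; yes; no)
open import Relation.Binary using (tri<; tri≈; tri>)
open import Relation.Binary.PropositionalEquality using (refl; sym; trans; cong; subst)
open Relation.Binary.PropositionalEquality.≡-Reasoning

open Equivalence using (to; from)

UnaryFormula : Set
UnaryFormula = ∀ {n} → Fin n → Formula n

-- "x has an immediate predecessor satisfying δ, among the elements satisfying δ":
-- ∃y. δ(y) ∧ y < x ∧ ∀z. ¬(δ(z) ∧ y < z ∧ z < x).
hasPredF : UnaryFormula → UnaryFormula
hasPredF δ x = ∃f (δ fzero ∧f (lt fzero (fsuc x)
  ∧f ∀f ((δ fzero ∧f (lt (fsuc fzero) fzero ∧f lt fzero (fsuc (fsuc x)))) ⇒f ⊥f)))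

-- The dual: ∃s. δ(s) ∧ x < s ∧ ∀z. ¬(δ(z) ∧ x < z ∧ z < s).
hasSuccF : UnaryFormula → UnaryFormula
hasSuccF δ x = ∃f (δ fzero ∧f (lt (fsuc x) fzero
  ∧f ∀f ((δ fzero ∧f (lt (fsuc (fsuc x)) fzero ∧f lt fzero (fsuc fzero))) ⇒f ⊥f)))

module Neighbours (S : Str) where
  open Str S using (Carrier; _≺_)

  Defines : UnaryFormula → (Carrier → Set) → Set
  Defines δ U = ∀ {n} (ρ : Fin n → Carrier) (x : Fin n) → Sat S ρ (δ x) ⇔ U (ρ x)

  Gap : (Carrier → Set) → Carrier → Carrier → Set
  Gap U y x = ∀ z → U z × (y ≺ z × z ≺ x) → ⊥

  Covers : (Carrier → Set) → Carrier → Carrier → Set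
  Covers U y x = y ≺ x × Gap U y x

  HasPred HasSucc : (Carrier → Set) → Carrier → Set
  HasPred U x = Σ Carrier λ y → U y × Covers U y x
  HasSucc U x = Σ Carrier λ s → U s × Covers U x s

  hasPred-defines : ∀ (δ : UnaryFormula) {U} → Defines δ U → Defines (hasPredF δ) (HasPred U)
  hasPred-defines δ def ρ x = mk⇔
    (λ (y , δy , y≺x , gap) → y , to (def _ fzero) δy , y≺x ,
       λ z (Uz , between) → gap z (from (def _ fzero) Uz , between))
    (λ (y , Uy , y≺x , gap) → y , from (def _ fzero) Uy , y≺x ,
       λ z (δz , between) → gap z (to (def _ fzero) δz , between))

  hasSucc-defines : ∀ (δ : UnaryFormula) {U} → Defines δ U → Defines (hasSuccF δ) (HasSucc U)
  hasSucc-defines δ def ρ x = mk⇔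
    (λ (s , δs , x≺s , gap) → s , to (def _ fzero) δs , x≺s ,
       λ z (Uz , between) → gap z (from (def _ fzero) Uz , between))
    (λ (s , Us , x≺s , gap) → s , from (def _ fzero) Us , x≺s ,
       λ z (δz , between) → gap z (to (def _ fzero) δz , between))

-- Defining formulas for Zₖ: Z₀ is everything, and Z_{k+1} consists of the elements
-- of Zₖ lacking an immediate predecessor or an immediate successor within Zₖ.
zeroBelowF : ℕ → UnaryFormula
zeroBelowF zero      x = ⊤f
zeroBelowF (suc k) x =
  zeroBelowF k x ∧f ((hasPredF (zeroBelowF k) x ∧f hasSuccF (zeroBelowF k) x) ⇒f ⊥f)

successorsF : ℕ → Sentence
successorsF k = ∀f (zeroBelowF k fzero ⇒f hasSuccF (zeroBelowF k) fzero)

ltBase-irrefl : ∀ b {u v} → u ≡ v → ¬ ltBase b u v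
ltBase-irrefl true  refl = <-irrefl refl
ltBase-irrefl false refl = <-irrefl refl

ltBase-trans : ∀ b {u v w} → ltBase b u v → ltBase b v w → ltBase b u w
ltBase-trans true  u<v v<w = <-trans u<v v<w
ltBase-trans false v<u w<v = <-trans w<v v<u

Next : OrdType → ℕ → ℕ → Set
Next true  u v = v ≡ suc u
Next false u v = u ≡ suc v

Next-lt : ∀ b {u v} → Next b u v → ltBase b u v
Next-lt true  refl = n<1+n _
Next-lt false refl = n<1+n _

Next-gap : ∀ b {u v w} → Next b u w → ltBase b u v → ltBase b v w → ⊥
Next-gap true  refl u<v v<w = <-irrefl refl (<-≤-trans u<v (s≤s⁻¹ v<w))
Next-gap false refl v<u w<v = <-irrefl refl (<-≤-trans w<v (s≤s⁻¹ v<u))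

nothing-below-zero : ∀ {b u v} → b ≡ true → v ≡ 0 → ¬ ltBase b u v
nothing-below-zero refl refl = n≮0

nothing-above-zero : ∀ {b u v} → b ≡ false → u ≡ 0 → ¬ ltBase b u v
nothing-above-zero refl refl = n≮0

update : FinSupp → ℕ → ℕ → FinSupp
update x k v = fs value (suc k ⊔ bound x) beyond-support
  where
  value : ℕ → ℕ
  value j with j ≟ k
  ... | yes _ = v
  ... | no  _ = fun x j

  beyond-support : ∀ j → suc k ⊔ bound x ≤ j → value j ≡ 0
  beyond-support j large with j ≟ k
  ... | yes refl = ⊥-elim (<-irrefl refl (<-≤-trans (n<1+n j) (m⊔n≤o⇒m≤o (suc j) (bound x) large)))
  ... | no  _    = vanish x j (m⊔n≤o⇒n≤o (suc k) (bound x) large)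

update-same : ∀ {x k v} → fun (update x k v) k ≡ v
update-same {k = k} with k ≟ k
... | yes _  = refl
... | no k≢k = ⊥-elim (k≢k refl)

update-other : ∀ {x k v j} → j ≢ k → fun (update x k v) j ≡ fun x j
update-other {k = k} {j = j} j≢k with j ≟ k
... | yes j≡k = ⊥-elim (j≢k j≡k)
... | no  _   = refl

module ProductOrder (X : ℕ → OrdType) where
  open Neighbours (Product X)

  _≺_ : FinSupp → FinSupp → Set
  _≺_ = Str._≺_ (Product X)

  record ZeroBelow (k : ℕ) (x : FinSupp) : Set where
    constructor zeroBelow
    field vanishes-below : ∀ j → j < k → fun x j ≡ 0
  open ZeroBelow

  zeroBelow-suc : ∀ {k x} → ZeroBelow (suc k) x ⇔ (ZeroBelow k x × fun x k ≡ 0)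
  zeroBelow-suc {k} = mk⇔
    (λ z → zeroBelow (λ j j<k → vanishes-below z j (m<n⇒m<1+n j<k)) , vanishes-below z k (n<1+n k))
    (λ (z , xk≡0) → zeroBelow λ j j<1+k → case-below z xk≡0 (m<1+n⇒m<n∨m≡n j<1+k))
    where
    case-below : ∀ {x j} → ZeroBelow k x → fun x k ≡ 0 → j < k ⊎ j ≡ k → fun x j ≡ 0
    case-below z _     (inj₁ j<k)  = vanishes-below z _ j<k
    case-below _ xk≡0 (inj₂ refl) = xk≡0

  AgreeAbove : ℕ → FinSupp → FinSupp → Set
  AgreeAbove k y x = ∀ j → k < j → fun y j ≡ fun x j

  witness-≥ : ∀ {k x y i} → ZeroBelow k x → ZeroBelow k y
    → ltBase (X i) (fun x i) (fun y i) → k ≤ i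
  witness-≥ {i = i} zx zy x<y = ≮⇒≥ λ i<k →
    ltBase-irrefl (X i) (trans (vanishes-below zx i i<k) (sym (vanishes-below zy i i<k))) x<y

  ≺-update-below : ∀ {x y k w i} → k < i → ltBase (X i) (fun x i) (fun y i)
    → AgreeAbove i x y → update x k w ≺ y × x ≺ update y k w
  ≺-update-below {x} {y} {k} {w} {i} k<i x<y agree =
    (i , subst (λ u → ltBase (X i) u (fun y i)) (sym (update-other (>⇒≢ k<i))) x<y ,
       λ j i<j → trans (update-other (>⇒≢ (<-trans k<i i<j))) (agree j i<j)) ,
    (i , subst (ltBase (X i) (fun x i)) (sym (update-other (>⇒≢ k<i))) x<y ,
       λ j i<j → trans (agree j i<j) (sym (update-other (>⇒≢ (<-trans k<i i<j)))))

  no-point-between : ∀ {k y x} → ZeroBelow k y → ZeroBelow k x → AgreeAbove k y x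
    → Next (X k) (fun y k) (fun x k) → Gap (ZeroBelow k) y x
  no-point-between zy zx agree next z (zz , (i , y<z , y=z) , (i' , z<x , z=x))
    with m≤n⇒m<n∨m≡n (witness-≥ zy zz y<z) | m≤n⇒m<n∨m≡n (witness-≥ zz zx z<x)
  ... | inj₂ refl | inj₂ refl = Next-gap (X i) next y<z z<x
  ... | inj₂ refl | inj₁ k<i' = ltBase-irrefl (X i') (trans (sym (y=z i' k<i')) (agree i' k<i')) z<x
  ... | inj₁ k<i  | inj₂ refl = ltBase-irrefl (X i) (trans (agree i k<i) (sym (z=x i k<i))) y<z
  ... | inj₁ k<i  | inj₁ k<i' with <-cmp i i'
  ...   | tri< i<i' _ _ = ltBase-irrefl (X i') (trans (sym (y=z i' i<i')) (agree i' k<i')) z<x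
  ...   | tri> _ _ i'<i = ltBase-irrefl (X i) (trans (agree i k<i) (sym (z=x i i'<i))) y<z
  ...   | tri≈ _ refl _ = ltBase-irrefl (X i) (agree i k<i) (ltBase-trans (X i) y<z z<x)

  covers-at : ∀ {k y x} → ZeroBelow k y → ZeroBelow k x → AgreeAbove k y x
    → Next (X k) (fun y k) (fun x k) → Covers (ZeroBelow k) y x
  covers-at {k} zy zx agree next = (k , Next-lt (X k) next , agree) , no-point-between zy zx agree next

  update-zeroBelow : ∀ {k x v} → ZeroBelow k x → ZeroBelow k (update x k v)
  update-zeroBelow zx = zeroBelow λ j j<k → trans (update-other (<⇒≢ j<k)) (vanishes-below zx j j<k)

  update-agrees : ∀ {k x v} → AgreeAbove k (update x k v) x
  update-agrees j k<j = update-other (>⇒≢ k<j)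

  covers-update-below : ∀ {k x v b} → X k ≡ b → ZeroBelow k x → Next b v (fun x k)
    → Covers (ZeroBelow k) (update x k v) x
  covers-update-below {k} {x} refl zx next =
    covers-at (update-zeroBelow zx) zx update-agrees
      (subst (λ u → Next (X k) u (fun x k)) (sym (update-same {x} {k})) next)

  covers-update-above : ∀ {k x v b} → X k ≡ b → ZeroBelow k x → Next b (fun x k) v
    → Covers (ZeroBelow k) x (update x k v)
  covers-update-above {k} {x} refl zx next =
    covers-at zx (update-zeroBelow zx) (λ j k<j → sym (update-agrees j k<j))
      (subst (Next (X k) (fun x k)) (sym (update-same {x} {k})) next)

  nonzero-has-neighbours : ∀ {k x a} → ZeroBelow k x → fun x k ≡ suc a
    → HasPred (ZeroBelow k) x × HasSucc (ZeroBelow k) x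
  nonzero-has-neighbours {k} {x} {a} zx xk≡1+a with X k in Xk
  ... | true  = (update x k a , update-zeroBelow zx , covers-update-below Xk zx xk≡1+a)
              , (update x k (suc (fun x k)) , update-zeroBelow zx , covers-update-above Xk zx refl)
  ... | false = (update x k (suc (fun x k)) , update-zeroBelow zx , covers-update-below Xk zx refl)
              , (update x k a , update-zeroBelow zx , covers-update-above Xk zx xk≡1+a)

  -- With k-th coordinate 0, x has no predecessor in Zₖ if Xₖ = ω: any y below x in Zₖ
  -- first differs from x at some index i > k, so raising y at k stays below x.
  zero-lacks-pred : ∀ {k x} → X k ≡ true → ZeroBelow k x → fun x k ≡ 0
    → ¬ HasPred (ZeroBelow k) x
  zero-lacks-pred {k} {x} ω zx xk≡0 (y , zy , (i , y<x , agree) , gap)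
    with m≤n⇒m<n∨m≡n (witness-≥ zy zx y<x)
  ... | inj₂ refl = nothing-below-zero ω xk≡0 y<x
  ... | inj₁ k<i  = gap raised (update-zeroBelow zy , y<raised , raised<x)
    where
    raised : FinSupp
    raised = update y k (suc (fun y k))
    y<raised : y ≺ raised
    y<raised = proj₁ (covers-update-above ω zy refl)
    raised<x : raised ≺ x
    raised<x = proj₁ (≺-update-below {y} {x} {k} {suc (fun y k)} k<i y<x agree)

  zero-lacks-succ : ∀ {k x} → X k ≡ false → ZeroBelow k x → fun x k ≡ 0
    → ¬ HasSucc (ZeroBelow k) x
  zero-lacks-succ {k} {x} ω* zx xk≡0 (s , zs , (i , x<s , agree) , gap)
    with m≤n⇒m<n∨m≡n (witness-≥ zx zs x<s)
  ... | inj₂ refl = nothing-above-zero ω* xk≡0 x<s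
  ... | inj₁ k<i  = gap raised (update-zeroBelow zs , x<raised , raised<s)
    where
    raised : FinSupp
    raised = update s k (suc (fun s k))
    x<raised : x ≺ raised
    x<raised = proj₂ (≺-update-below {x} {s} {k} {suc (fun s k)} k<i x<s agree)
    raised<s : raised ≺ s
    raised<s = proj₁ (covers-update-below ω* zs refl)

  both-neighbours⇒nonzero : ∀ {k x} → ZeroBelow k x → fun x k ≡ 0
    → ¬ (HasPred (ZeroBelow k) x × HasSucc (ZeroBelow k) x)
  both-neighbours⇒nonzero {k} zx xk≡0 (p , s) with X k in Xk
  ... | true  = zero-lacks-pred Xk zx xk≡0 p
  ... | false = zero-lacks-succ Xk zx xk≡0 s

  no-neighbours⇒zero : ∀ {k x} → ZeroBelow k x
    → ¬ (HasPred (ZeroBelow k) x × HasSucc (ZeroBelow k) x) → fun x k ≡ 0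
  no-neighbours⇒zero {k} {x} zx not-both with fun x k in xk
  ... | zero  = refl
  ... | suc a = ⊥-elim (not-both (nonzero-has-neighbours zx xk))

  zeroBelow-defines : ∀ k → Defines (zeroBelowF k) (ZeroBelow k)
  zeroBelow-defines zero    ρ x = mk⇔ (λ _ → zeroBelow λ _ ()) (λ _ → tt)
  zeroBelow-defines (suc k) ρ x = mk⇔ defined⇒zeroBelow zeroBelow⇒defined
    where
    below : Defines (zeroBelowF k) (ZeroBelow k)
    below = zeroBelow-defines k

    neighbours : Sat (Product X) ρ (hasPredF (zeroBelowF k) x ∧f hasSuccF (zeroBelowF k) x)
               ⇔ (HasPred (ZeroBelow k) (ρ x) × HasSucc (ZeroBelow k) (ρ x))
    neighbours = mk⇔ (λ (p , s) → to predₖ p , to succₖ s) (λ (p , s) → from predₖ p , from succₖ s)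
      where
      predₖ : Sat (Product X) ρ (hasPredF (zeroBelowF k) x) ⇔ HasPred (ZeroBelow k) (ρ x)
      predₖ = hasPred-defines (zeroBelowF k) below ρ x
      succₖ : Sat (Product X) ρ (hasSuccF (zeroBelowF k) x) ⇔ HasSucc (ZeroBelow k) (ρ x)
      succₖ = hasSucc-defines (zeroBelowF k) below ρ x

    defined⇒zeroBelow : Sat (Product X) ρ (zeroBelowF (suc k) x) → ZeroBelow (suc k) (ρ x)
    defined⇒zeroBelow (δx , not-both) =
      from zeroBelow-suc (zx , no-neighbours⇒zero zx (not-both ∘ from neighbours))
      where
      zx : ZeroBelow k (ρ x)
      zx = to (below ρ x) δx

    zeroBelow⇒defined : ZeroBelow (suc k) (ρ x) → Sat (Product X) ρ (zeroBelowF (suc k) x)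
    zeroBelow⇒defined zx with to zeroBelow-suc zx
    ... | zx' , xk≡0 = from (below ρ x) zx' , both-neighbours⇒nonzero zx' xk≡0 ∘ to neighbours

  origin : FinSupp
  origin = fs (λ _ → 0) 0 (λ _ _ → refl)

  origin-zeroBelow : ∀ {k} → ZeroBelow k origin
  origin-zeroBelow = zeroBelow λ _ _ → refl

  -- The sentence successorsF k detects whether the k-th factor is ω: in ω every
  -- element of Zₖ can be raised at k, while in ω* the origin has no successor in Zₖ.
  successors⇔ω : ∀ k → Product X ⊨ successorsF k ⇔ X k ≡ true
  successors⇔ω k = mk⇔ forward backward
    where
    below : Defines (zeroBelowF k) (ZeroBelow k)
    below = zeroBelow-defines k

    forward : Product X ⊨ successorsF k → X k ≡ true
    forward all-succ with X k in Xk
    ... | true  = refl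
    ... | false = ⊥-elim (zero-lacks-succ Xk origin-zeroBelow refl origin-succ)
      where
      origin-succ : HasSucc (ZeroBelow k) origin
      origin-succ = to (hasSucc-defines (zeroBelowF k) below _ fzero)
                       (all-succ origin (from (below _ fzero) origin-zeroBelow))

    backward : X k ≡ true → Product X ⊨ successorsF k
    backward ω x δx = from (hasSucc-defines (zeroBelowF k) below _ fzero)
      (update x k (suc (fun x k)) , update-zeroBelow zx , covers-update-above ω zx refl)
      where
      zx : ZeroBelow k x
      zx = to (below _ fzero) δx

product-transfer : ∀ {X Y} → (∀ k → X k ≡ Y k) → ∀ {n} (ρ : Fin n → FinSupp) φ
  → Sat (Product X) ρ φ → Sat (Product Y) ρ φ
product-transfer e ρ (eq i j)  h            = h
product-transfer e ρ (lt i j)  (p , l , a)  = p , subst (λ b → ltBase b _ _) (e p) l , a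
product-transfer e ρ ⊥f        h            = h
product-transfer e ρ ⊤f        h            = h
product-transfer e ρ (φ ∧f ψ)  (h₁ , h₂)    = product-transfer e ρ φ h₁ , product-transfer e ρ ψ h₂
product-transfer e ρ (φ ∨f ψ)  (inj₁ h)     = inj₁ (product-transfer e ρ φ h)
product-transfer e ρ (φ ∨f ψ)  (inj₂ h)     = inj₂ (product-transfer e ρ ψ h)
product-transfer e ρ (φ ⇒f ψ)  h            =
  product-transfer e ρ ψ ∘ h ∘ product-transfer (sym ∘ e) ρ φ
product-transfer e ρ (∀f φ)    h            = λ a → product-transfer e _ φ (h a)
product-transfer e ρ (∃f φ)    (a , h)      = a , product-transfer e _ φ h

product-congruence : ∀ {X Y} → (∀ k → X k ≡ Y k) → Product X ≡ₑ Product Y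
product-congruence e φ = product-transfer e _ φ , product-transfer (sym ∘ e) _ φ

bool-ext : ∀ {a b} → (a ≡ true → b ≡ true) → (b ≡ true → a ≡ true) → a ≡ b
bool-ext {true}  f _ = sym (f refl)
bool-ext {false} {true}  _ g = g refl
bool-ext {false} {false} _ _ = refl

factors-invariant : ∀ {X Y} → Product X ≡ₑ Product Y → ∀ k → X k ≡ Y k
factors-invariant {X} {Y} E k = bool-ext
  (λ ω → to (Y.successors⇔ω k) (proj₁ (E (successorsF k)) (from (X.successors⇔ω k) ω)))
  (λ ω → to (X.successors⇔ω k) (proj₂ (E (successorsF k)) (from (Y.successors⇔ω k) ω)))
  where
  module X = ProductOrder X
  module Y = ProductOrder Y

step : (ℕ → ℕ) → ℕ × ℕ → ℕ × ℕ
step m (i , u) = if suc u <ᵇ m i then (i , suc u) else (suc i , 0)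

block-suc : ∀ m k → block m (suc k) ≡ step m (block m k)
block-suc m k = refl

step-within : ∀ m {i u} → suc u < m i → step m (i , u) ≡ (i , suc u)
step-within m {i} {u} u<m with suc u <ᵇ m i | <⇒<ᵇ u<m
... | true | _ = refl

step-exit : ∀ m {i u} → ¬ suc u < m i → step m (i , u) ≡ (suc i , 0)
step-exit m {i} {u} ¬u<m with suc u <ᵇ m i | <ᵇ⇒< (suc u) (m i)
... | true  | u<m = ⊥-elim (¬u<m (u<m tt))
... | false | _  = refl

positive : ∀ {x} → 1 ≤ x → ∃ λ a → suc a ≡ x
positive {suc a} _ = a , refl

module Blocks (m : ℕ → ℕ) (m-pos : ∀ i → 1 ≤ m i) where
  mutual
    block-reached : ∀ i u → u < m i → ∃ λ k → block m k ≡ (i , u)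
    block-reached zero    zero _ = 0 , refl
    block-reached (suc i) zero _ = let (k , _ , _ , _ , next) = block-end i in suc k , next
    block-reached i (suc u) u<m with block-reached i u (<-trans (n<1+n u) u<m)
    ... | k , at = suc k , trans (cong (step m) at) (step-within m u<m)

    block-end : ∀ i → ∃₂ λ k a →
      suc a ≡ m i × block m k ≡ (i , a) × block m (suc k) ≡ (suc i , 0)
    block-end i with positive (m-pos i)
    ... | a , last with block-reached i a (subst (a <_) last (n<1+n a))
    ...   | k , at = k , a , last , at , trans (cong (step m) at) (step-exit m (<-irrefl last))

-- If M^m and M^n have the same block positions, then nᵢ ≤ mᵢ: otherwise M^n would
-- continue block i where M^m has already moved on to block i + 1.
exponent-bound : ∀ {m n} → (∀ i → 1 ≤ m i) → (∀ k → block m k ≡ block n k) → ∀ i → n i ≤ m i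
exponent-bound {m} {n} m-pos same i with Blocks.block-end m m-pos i
... | k , a , last , at , next = ≮⇒≥ λ longer → <⇒≢ (n<1+n i) (cong proj₁ (begin
  (i , suc a)         ≡⟨ sym (step-within n (subst (_< n i) (sym last) longer)) ⟩
  step n (i , a)      ≡⟨ cong (step n) (trans (sym (same k)) at) ⟨
  block n (suc k)     ≡⟨ sym (same (suc k)) ⟩
  block m (suc k)     ≡⟨ next ⟩
  (suc i , 0)         ∎))

exponents-from-blocks : ∀ {m n} → (∀ i → 1 ≤ m i) → (∀ i → 1 ≤ n i)
  → (∀ k → block m k ≡ block n k) → ∀ i → m i ≡ n i
exponents-from-blocks m-pos n-pos same i =
  ≤-antisym (exponent-bound n-pos (sym ∘ same) i) (exponent-bound m-pos same i)

-- When M alternates, a step stays in the same block iff the order type is unchanged.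
steps-agree : ∀ {M : ℕ → OrdType} → (∀ i → M (suc i) ≢ M i) → ∀ {m n} p q → p ≡ q
  → M (proj₁ (step m p)) ≡ M (proj₁ (step n q)) → step m p ≡ step n q
steps-agree alt {m} {n} (i , u) .(i , u) refl same-type with suc u <ᵇ m i | suc u <ᵇ n i
... | true  | true  = refl
... | false | false = refl
... | true  | false = ⊥-elim (alt i (sym same-type))
... | false | true  = ⊥-elim (alt i same-type)

blocks-from-factors : ∀ {M : ℕ → OrdType} {m n} → (∀ i → M (suc i) ≢ M i)
  → (∀ k → factor M m k ≡ factor M n k) → ∀ k → block m k ≡ block n k
blocks-from-factors alt same zero    = refl
blocks-from-factors {M} {m} {n} alt same (suc k) =
  steps-agree {M} alt {m} {n} (block m k) (block n k) (blocks-from-factors alt same k) (same (suc k))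

step-ext : ∀ {m n} → (∀ i → m i ≡ n i) → ∀ p → step m p ≡ step n p
step-ext e (i , u) rewrite e i = refl

blocks-from-exponents : ∀ {m n} → (∀ i → m i ≡ n i) → ∀ k → block m k ≡ block n k
blocks-from-exponents e zero    = refl
blocks-from-exponents {m} {n} e (suc k) = begin
  block m (suc k)       ≡⟨ block-suc m k ⟩
  step m (block m k)    ≡⟨ cong (step m) (blocks-from-exponents e k) ⟩
  step m (block n k)    ≡⟨ step-ext e (block n k) ⟩
  step n (block n k)    ∎

corollary3p7 : (M : ℕ → Bool) → (∀ i → M (suc i) ≢ M i)
    → (m n : ℕ → ℕ) → (∀ i → 1 ≤ m i) → (∀ i → 1 ≤ n i)
    → ((Monomial M m ≡ₑ Monomial M n → ∀ i → m i ≡ n i)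
       × ((∀ i → m i ≡ n i) → Monomial M m ≡ₑ Monomial M n))
corollary3p7 M alt m n m-pos n-pos = exponents-equal , monomials-equivalent
  where
  exponents-equal : Monomial M m ≡ₑ Monomial M n → ∀ i → m i ≡ n i
  exponents-equal E =
    exponents-from-blocks m-pos n-pos (blocks-from-factors alt (factors-invariant E))

  monomials-equivalent : (∀ i → m i ≡ n i) → Monomial M m ≡ₑ Monomial M n
  monomials-equivalent e = product-congruence (cong (M ∘ proj₁) ∘ blocks-from-exponents e)
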